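{- For every $k \in \mathbb{N}$, the positive integer $\mathrm{lcm}(1, 2, \dots, k-1)$ is a period of the sequence $$\left(\frac{\binom{n}{k}}{\left[\begin{array}{c} n \\ k \end{array}\right]}\right)_{n \geq k}, \qquad \text{where } \left[\begin{array}{c} n \\ k \end{array}\right] := \frac{\mathrm{lcm}(n, n-1, \dots, n-k+1)}{\mathrm{lcm}(1, 2, \dots, k)}.$$
   Context: $\mathbb{N}$ denotes the set of nonnegative integers. The least common multiple of the empty set is taken to be $1$ (e.g. $\mathrm{lcm}(1,\dots,k-1)=1$ for $k \le 1$). A positive integer $T$ is a period of a sequence $(u_n)_{n\ge k}$ if $u_{n+T}=u_n$ for all $n \geq k$. -}

module Defs where

open import Data.Nat using (ℕ; zero; suc; _∸_)
open import Data.Nat.LCM using (lcm)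
open import Data.Nat.Combinatorics using (_C_)
open import Data.List using (List; foldr; map; upTo)
open import Data.Integer using (+_)
open import Data.Rational using (ℚ; 0ℚ; _/_; _÷_; _≟_; ≢-nonZero)
open import Relation.Nullary using (yes; no)

lcmList : List ℕ → ℕ
lcmList = foldr lcm 1

lcmUpTo : ℕ → ℕ
lcmUpTo k = lcmList (map suc (upTo k))

lcmDesc : ℕ → ℕ → ℕ
lcmDesc n k = lcmList (map (λ i → n ∸ i) (upTo k))

frac : ℕ → ℕ → ℚ
frac a zero    = 0ℚ
frac a (suc b) = (+ a) / suc b

divℚ : ℚ → ℚ → ℚ
divℚ p q with q ≟ 0ℚ
... | yes _ = 0ℚ
... | no q≢0 = _÷_ p q {{≢-nonZero q≢0}}

lcmBinom : ℕ → ℕ → ℚ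
lcmBinom n k = frac (lcmDesc n k) (lcmUpTo k)

ratio : ℕ → ℕ → ℚ
ratio k n = divℚ (frac (n C k) 1) (lcmBinom n k)

-- C(n,k)·k! is the falling factorial n(n−1)⋯(n−k+1), and peeling off one factor at a time
-- writes it as Q(n,k)·lcm(n,…,n−k+1), where Q(n,k) is the product over i < k of
-- gcd(n−i, lcm(n−i−1,…,n−k+1)).  Since gcd distributes over lcm and gcd(m, m−j) = gcd(m, j),
-- each such factor is lcm_j gcd(n−i, j) over 1 ≤ j < k−i, so Q(n,k) only depends on n modulo
-- lcm(1,…,k−1).  Hence so does C(n,k)/[n k] = Q(n,k)·lcm(1,…,k)/k!.
module Submission where

open import Data.Nat
open import Data.Nat.Properties
open import Data.Nat.Divisibility
open import Data.Nat.GCD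
open import Data.Nat.LCM
open import Data.Nat.DivMod using (_/_; m/n*n≡m)
open import Data.Nat.Combinatorics using (_C_; nCk≡nPk/k!)
open import Data.Nat.Combinatorics.Base using (_P′_; _P_)
open import Data.Nat.Combinatorics.Specification
  using (k!∣nP′k; nP′k≡n[n∸1P′k∸1]; nPk≡n!/[n∸k]!; nP′k≡n!/[n∸k]!)
open import Data.Integer as ℤ using (+_)
import Data.Integer.Properties as ℤ
open import Data.Rational as ℚ using (ℚ; 0ℚ; 1ℚ; _÷_; 1/_; toℚᵘ)
import Data.Rational.Properties as ℚ
open import Data.Rational.Unnormalised as ℚᵘ using (mkℚᵘ)
import Data.Rational.Unnormalised.Properties as ℚᵘ
open import Data.List using ([]; _∷_; upTo; applyUpTo)
open import Data.List.Properties using (map-applyUpTo)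
open import Data.List.Relation.Unary.All using (All; []; _∷_; universal)
open import Data.List.Relation.Unary.All.Properties using (map⁺)
open import Data.List.Relation.Unary.Any using (here; there)
open import Data.List.Membership.Propositional using (_∈_)
open import Data.List.Membership.Propositional.Properties using (∈-map⁺; ∈-upTo⁺)
open import Data.Product using (_×_; _,_)
open import Function using (_∘_; id)
open import Relation.Binary.PropositionalEquality
open import Relation.Nullary using (yes; no; contradiction)
open import Algebra.Bundles using (CommutativeRing)
import Algebra.Properties.CommutativeSemigroup as CommutativeSemigroupProperties
open CommutativeSemigroupProperties *-commutativeSemigroup using (x∙yz≈y∙xz; x∙yz≈yx∙z; xy∙z≈xz∙y)
open import Defs

gcd[m*o,n*o]≡gcd[m,n]*o : ∀ m n o → gcd (m * o) (n * o) ≡ gcd m n * o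
gcd[m*o,n*o]≡gcd[m,n]*o m n o = begin
  gcd (m * o) (n * o) ≡⟨ cong₂ gcd (*-comm m o) (*-comm n o) ⟩
  gcd (o * m) (o * n) ≡⟨ c*gcd[m,n]≡gcd[cm,cn] o m n ⟨
  o * gcd m n         ≡⟨ *-comm o (gcd m n) ⟩
  gcd m n * o         ∎
  where open ≡-Reasoning

∣gcd*gcd : ∀ {d} a b c e → d ∣ a * c → d ∣ a * e → d ∣ b * c → d ∣ b * e →
           d ∣ gcd a b * gcd c e
∣gcd*gcd {d} a b c e d∣ac d∣ae d∣bc d∣be =
  subst (d ∣_) (gcd[m*o,n*o]≡gcd[m,n]*o a b (gcd c e))
    (gcd-greatest (∣x*g a d∣ac d∣ae) (∣x*g b d∣bc d∣be))
  where
  ∣x*g : ∀ x → d ∣ x * c → d ∣ x * e → d ∣ x * gcd c e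
  ∣x*g x d∣xc d∣xe = subst (d ∣_) (sym (c*gcd[m,n]≡gcd[cm,cn] x c e)) (gcd-greatest d∣xc d∣xe)

gcd-lcm-distribˡ : ∀ a b c → gcd a (lcm b c) ≡ lcm (gcd a b) (gcd a c)
gcd-lcm-distribˡ zero b c =
  trans (gcd-identityˡ (lcm b c)) (sym (cong₂ lcm (gcd-identityˡ b) (gcd-identityˡ c)))
-- For g ∣ lcm u v it suffices that g·t ∣ lcm u v · t = u·v with t = gcd u v, which is nonzero
-- because a is; and g·t divides each of the four products a·a, a·c, b·a, b·c spanning u·v.
gcd-lcm-distribˡ a@(suc _) b c = ∣-antisym g∣w w∣g
  where
  g = gcd a (lcm b c)
  u = gcd a b
  v = gcd a c
  t = gcd u v
  g∣a = gcd[m,n]∣m a (lcm b c)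
  t∣u = gcd[m,n]∣m u v
  t∣v = gcd[m,n]∣n u v
  w∣g : lcm u v ∣ g
  w∣g = lcm-least (gcd-greatest (gcd[m,n]∣m a b) (∣-trans (gcd[m,n]∣n a b) (m∣lcm[m,n] b c)))
                  (gcd-greatest (gcd[m,n]∣m a c) (∣-trans (gcd[m,n]∣n a c) (n∣lcm[m,n] b c)))
  t∣a : t ∣ a
  t∣a = ∣-trans t∣u (gcd[m,n]∣m a b)
  t∣b : t ∣ b
  t∣b = ∣-trans t∣u (gcd[m,n]∣n a b)
  t∣c : t ∣ c
  t∣c = ∣-trans t∣v (gcd[m,n]∣n a c)
  instance
    _ : NonZero t
    _ = ≢-nonZero λ t≡0 → ≢-nonZero⁻¹ a (gcd[m,n]≡0⇒m≡0 {a} {b} (gcd[m,n]≡0⇒m≡0 {u} {v} t≡0))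
  gt∣bc : g * t ∣ b * c
  gt∣bc = subst (g * t ∣_) (trans (*-comm (lcm b c) (gcd b c)) (gcd*lcm b c))
            (*-pres-∣ (gcd[m,n]∣n a (lcm b c)) (gcd-greatest t∣b t∣c))
  gt∣uv : g * t ∣ u * v
  gt∣uv = ∣gcd*gcd a b a c (*-pres-∣ g∣a t∣a) (*-pres-∣ g∣a t∣c)
            (subst (g * t ∣_) (*-comm a b) (*-pres-∣ g∣a t∣b)) gt∣bc
  g∣w : g ∣ lcm u v
  g∣w = *-cancelʳ-∣ t (subst (g * t ∣_) (trans (sym (gcd*lcm u v)) (*-comm t (lcm u v))) gt∣uv)

gcd[m+n,m]≡gcd[m+n,n] : ∀ m n → gcd (m + n) m ≡ gcd (m + n) n
gcd[m+n,m]≡gcd[m+n,n] m n = ∣-antisym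
  (gcd-greatest (gcd[m,n]∣m (m + n) m) (∣m+n∣m⇒∣n (gcd[m,n]∣m (m + n) m) (gcd[m,n]∣n (m + n) m)))
  (gcd-greatest (gcd[m,n]∣m (m + n) n) (∣m+n∣m⇒∣n g′∣n+m (gcd[m,n]∣n (m + n) n)))
  where
  g′∣n+m : gcd (m + n) n ∣ n + m
  g′∣n+m = subst (gcd (m + n) n ∣_) (+-comm m n) (gcd[m,n]∣m (m + n) n)

gcd[m+o,n]≡gcd[m,n] : ∀ m n o → n ∣ o → gcd (m + o) n ≡ gcd m n
gcd[m+o,n]≡gcd[m,n] m n o n∣o = ∣-antisym
  (gcd-greatest (∣m+n∣m⇒∣n g∣o+m (∣-trans (gcd[m,n]∣n (m + o) n) n∣o)) (gcd[m,n]∣n (m + o) n))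
  (gcd-greatest (∣m∣n⇒∣m+n (gcd[m,n]∣m m n) (∣-trans (gcd[m,n]∣n m n) n∣o)) (gcd[m,n]∣n m n))
  where
  g∣o+m : gcd (m + o) n ∣ o + m
  g∣o+m = subst (gcd (m + o) n ∣_) (+-comm m o) (gcd[m,n]∣m (m + o) n)

lcm-nonZero : ∀ m n .{{_ : NonZero m}} .{{_ : NonZero n}} → NonZero (lcm m n)
lcm-nonZero m n = ≢-nonZero λ lcm≡0 → ≢-nonZero⁻¹ (m * n) {{m*n≢0 m n}} (begin
  m * n             ≡⟨ gcd*lcm m n ⟨
  gcd m n * lcm m n ≡⟨ cong (gcd m n *_) lcm≡0 ⟩
  gcd m n * 0       ≡⟨ *-zeroʳ (gcd m n) ⟩
  0                 ∎)
  where open ≡-Reasoning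

lcmList-nonZero : ∀ {xs} → All NonZero xs → NonZero (lcmList xs)
lcmList-nonZero []                     = _
lcmList-nonZero {x ∷ xs} (x≢0 ∷ xs≢0) = lcm-nonZero x (lcmList xs) {{x≢0}} {{lcmList-nonZero xs≢0}}

∈⇒∣lcmList : ∀ {x xs} → x ∈ xs → x ∣ lcmList xs
∈⇒∣lcmList {xs = _ ∷ xs} (here refl) = m∣lcm[m,n] _ (lcmList xs)
∈⇒∣lcmList {xs = y ∷ _}  (there x∈xs) = ∣-trans (∈⇒∣lcmList x∈xs) (n∣lcm[m,n] y _)

lcmUpTo-nonZero : ∀ k → NonZero (lcmUpTo k)
lcmUpTo-nonZero k = lcmList-nonZero (map⁺ (universal (λ _ → _) (upTo k)))

1+i∣lcmUpTo : ∀ {i k} → i < k → suc i ∣ lcmUpTo k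
1+i∣lcmUpTo i<k = ∈⇒∣lcmList (∈-map⁺ suc (∈-upTo⁺ i<k))

fallingLcm : ℕ → ℕ → ℕ
fallingLcm n k = lcmList (applyUpTo (n ∸_) k)

lcmDesc≡fallingLcm : ∀ n k → lcmDesc n k ≡ fallingLcm n k
lcmDesc≡fallingLcm n k = cong lcmList (map-applyUpTo id (n ∸_) k)

fallingLcm-nonZero : ∀ {n k} → k ≤ n → NonZero (fallingLcm n k)
fallingLcm-nonZero {k = zero}        _         = _
fallingLcm-nonZero {suc m} {suc k} (s≤s k≤m) =
  lcm-nonZero (suc m) (fallingLcm m k) {{_}} {{fallingLcm-nonZero k≤m}}

gcd-lcmList-applyUpTo-cong : ∀ a a′ k (f g : ℕ → ℕ) → (∀ i → i < k → gcd a (f i) ≡ gcd a′ (g i)) →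
                             gcd a (lcmList (applyUpTo f k)) ≡ gcd a′ (lcmList (applyUpTo g k))
gcd-lcmList-applyUpTo-cong a a′ zero    f g _  = trans (gcd-zeroʳ a) (sym (gcd-zeroʳ a′))
gcd-lcmList-applyUpTo-cong a a′ (suc k) f g eq = begin
  gcd a (lcm (f 0) (lcmList (applyUpTo (f ∘ suc) k)))
    ≡⟨ gcd-lcm-distribˡ a (f 0) _ ⟩
  lcm (gcd a (f 0)) (gcd a (lcmList (applyUpTo (f ∘ suc) k)))
    ≡⟨ cong₂ lcm (eq 0 z<s) (gcd-lcmList-applyUpTo-cong a a′ k (f ∘ suc) (g ∘ suc) (λ i → eq (suc i) ∘ s≤s)) ⟩
  lcm (gcd a′ (g 0)) (gcd a′ (lcmList (applyUpTo (g ∘ suc) k)))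
    ≡⟨ gcd-lcm-distribˡ a′ (g 0) _ ⟨
  gcd a′ (lcm (g 0) (lcmList (applyUpTo (g ∘ suc) k)))
    ∎
  where open ≡-Reasoning

fallingLcmCofactor : ℕ → ℕ → ℕ
fallingLcmCofactor n       zero    = 1
fallingLcmCofactor zero    (suc k) = 0
fallingLcmCofactor (suc m) (suc k) = gcd (suc m) (fallingLcm m k) * fallingLcmCofactor m k

nP′k≡fallingLcmCofactor*fallingLcm : ∀ {n k} → k ≤ n → (n P′ k) ≡ fallingLcmCofactor n k * fallingLcm n k
nP′k≡fallingLcmCofactor*fallingLcm {k = zero}        _         = refl
nP′k≡fallingLcmCofactor*fallingLcm {suc m} {suc k} (s≤s k≤m) = begin
  (suc m P′ suc k)  ≡⟨ nP′k≡n[n∸1P′k∸1] (suc m) (suc k) ⟩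
  suc m * (m P′ k)  ≡⟨ cong (suc m *_) (nP′k≡fallingLcmCofactor*fallingLcm k≤m) ⟩
  suc m * (c * l)   ≡⟨ x∙yz≈y∙xz (suc m) c l ⟩
  c * (suc m * l)   ≡⟨ cong (c *_) (gcd*lcm (suc m) l) ⟨
  c * (g * l′)      ≡⟨ x∙yz≈yx∙z c g l′ ⟩
  g * c * l′        ∎
  where
  open ≡-Reasoning
  c = fallingLcmCofactor m k
  l = fallingLcm m k
  g = gcd (suc m) l
  l′ = lcm (suc m) l

gcd[1+m,m∸i]≡gcd[1+m,1+i] : ∀ {m i} → i ≤ m → gcd (suc m) (m ∸ i) ≡ gcd (suc m) (suc i)
gcd[1+m,m∸i]≡gcd[1+m,1+i] {m} {i} i≤m =
  subst (λ s → gcd s (m ∸ i) ≡ gcd s (suc i)) m∸i+1+i≡1+m (gcd[m+n,m]≡gcd[m+n,n] (m ∸ i) (suc i))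
  where
  m∸i+1+i≡1+m : m ∸ i + suc i ≡ suc m
  m∸i+1+i≡1+m = trans (+-suc (m ∸ i) i) (cong suc (m∸n+n≡m i≤m))

fallingLcmCofactor-periodic : ∀ {n k} T → k ≤ n → (∀ i → suc i < k → suc i ∣ T) →
                              fallingLcmCofactor (n + T) k ≡ fallingLcmCofactor n k
fallingLcmCofactor-periodic {k = zero}        T _         _   = refl
fallingLcmCofactor-periodic {suc m} {suc k} T (s≤s k≤m) ∣T = cong₂ _*_
  (gcd-lcmList-applyUpTo-cong (suc m + T) (suc m) k (m + T ∸_) (m ∸_) shift)
  (fallingLcmCofactor-periodic T k≤m (λ i 1+i<k → ∣T i (m<n⇒m<1+n 1+i<k)))
  where
  shift : ∀ i → i < k → gcd (suc m + T) (m + T ∸ i) ≡ gcd (suc m) (m ∸ i)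
  shift i i<k = begin
    gcd (suc m + T) (m + T ∸ i) ≡⟨ gcd[1+m,m∸i]≡gcd[1+m,1+i] (≤-trans i≤m (m≤m+n m T)) ⟩
    gcd (suc m + T) (suc i)     ≡⟨ gcd[m+o,n]≡gcd[m,n] (suc m) (suc i) T (∣T i (s≤s i<k)) ⟩
    gcd (suc m) (suc i)         ≡⟨ gcd[1+m,m∸i]≡gcd[1+m,1+i] i≤m ⟨
    gcd (suc m) (m ∸ i)         ∎
    where
    open ≡-Reasoning
    i≤m = ≤-trans (<⇒≤ i<k) k≤m

nCk*k!≡nP′k : ∀ {n k} → k ≤ n → (n C k) * k ! ≡ (n P′ k)
nCk*k!≡nP′k {n} {k} k≤n = begin
  (n C k) * k !           ≡⟨ cong (_* k !) (nCk≡nPk/k! k≤n) ⟩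
  (n P k) / k ! * k !     ≡⟨ cong (λ p → p / k ! * k !) (trans (nPk≡n!/[n∸k]! k≤n) (sym (nP′k≡n!/[n∸k]! k≤n))) ⟩
  (n P′ k) / k ! * k !    ≡⟨ m/n*n≡m (k!∣nP′k k≤n) ⟩
  (n P′ k)                ∎
  where
  open ≡-Reasoning
  instance _ = k !≢0

*-cross : ∀ {x y x′ y′ q} o .{{_ : NonZero o}} → x * o ≡ q * y → x′ * o ≡ q * y′ → x′ * y ≡ x * y′
*-cross {x} {y} {x′} {y′} {q} o xo≡qy x′o≡qy′ = *-cancelʳ-≡ (x′ * y) (x * y′) o (begin
  x′ * y * o   ≡⟨ xy∙z≈xz∙y x′ y o ⟩
  x′ * o * y   ≡⟨ cong (_* y) x′o≡qy′ ⟩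
  q * y′ * y   ≡⟨ xy∙z≈xz∙y q y′ y ⟩
  q * y * y′   ≡⟨ cong (_* y′) xo≡qy ⟨
  x * o * y′   ≡⟨ xy∙z≈xz∙y x o y′ ⟩
  x * y′ * o   ∎)
  where open ≡-Reasoning

binomial*fallingLcm-periodic : ∀ {n k} T → k ≤ n → (∀ i → suc i < k → suc i ∣ T) →
  ((n + T) C k) * fallingLcm n k ≡ (n C k) * fallingLcm (n + T) k
binomial*fallingLcm-periodic {n} {k} T k≤n ∣T =
  *-cross {x = n C k} {x′ = (n + T) C k} {q = fallingLcmCofactor n k} (k !) {{k !≢0}}
    (decompose k≤n)
    (trans (decompose (≤-trans k≤n (m≤m+n n T)))
           (cong (_* fallingLcm (n + T) k) (fallingLcmCofactor-periodic T k≤n ∣T)))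
  where
  decompose : ∀ {m} → k ≤ m → (m C k) * k ! ≡ fallingLcmCofactor m k * fallingLcm m k
  decompose k≤m = trans (nCk*k!≡nP′k k≤m) (nP′k≡fallingLcmCofactor*fallingLcm k≤m)

frac-* : ∀ a b u v → frac a (suc u) ℚ.* frac b (suc v) ≡ frac (a * b) (suc u * suc v)
frac-* a b u v = ℚ.toℚᵘ-injective (begin
  toℚᵘ (frac a (suc u) ℚ.* frac b (suc v))
    ≈⟨ ℚ.toℚᵘ-homo-* (frac a (suc u)) (frac b (suc v)) ⟩
  toℚᵘ (frac a (suc u)) ℚᵘ.* toℚᵘ (frac b (suc v))
    ≈⟨ ℚᵘ.*-cong (ℚ.toℚᵘ-fromℚᵘ (mkℚᵘ (+ a) u)) (ℚ.toℚᵘ-fromℚᵘ (mkℚᵘ (+ b) v)) ⟩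
  mkℚᵘ (+ a ℤ.* + b) d
    ≡⟨ cong (λ i → mkℚᵘ i d) (ℤ.pos-* a b) ⟨
  mkℚᵘ (+ (a * b)) d
    ≈⟨ ℚ.toℚᵘ-fromℚᵘ (mkℚᵘ (+ (a * b)) d) ⟨
  toℚᵘ (frac (a * b) (suc u * suc v))
    ∎)
  where
  open ℚᵘ.≃-Reasoning
  d = v + u * suc v

frac-cross : ∀ {a b a′ b′} u → a * b′ ≡ a′ * b →
             frac a 1 ℚ.* frac b′ (suc u) ≡ frac a′ 1 ℚ.* frac b (suc u)
frac-cross {a} {b} {a′} {b′} u ab′≡a′b = begin
  frac a 1 ℚ.* frac b′ (suc u)  ≡⟨ frac-* a b′ 0 u ⟩
  frac (a * b′) (1 * suc u)     ≡⟨ cong (λ c → frac c (1 * suc u)) ab′≡a′b ⟩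
  frac (a′ * b) (1 * suc u)     ≡⟨ frac-* a′ b 0 u ⟨
  frac a′ 1 ℚ.* frac b (suc u)  ∎
  where open ≡-Reasoning

frac≢0 : ∀ a u .{{_ : NonZero a}} → frac a (suc u) ≢ 0ℚ
frac≢0 a u eq = NonZero.nonZero
  (subst ℚ.NonZero eq (ℚ.pos⇒nonZero (frac a (suc u)) {{ℚ.normalize-pos a (suc u)}}))

module _ {q : ℚ} .{{_ : ℚ.NonZero q}} where

  p÷q*q≡p : ∀ p → p ÷ q ℚ.* q ≡ p
  p÷q*q≡p p = begin
    p ℚ.* 1/ q ℚ.* q     ≡⟨ ℚ.*-assoc p (1/ q) q ⟩
    p ℚ.* (1/ q ℚ.* q)   ≡⟨ cong (p ℚ.*_) (ℚ.*-inverseˡ q) ⟩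
    p ℚ.* 1ℚ             ≡⟨ ℚ.*-identityʳ p ⟩
    p                    ∎
    where open ≡-Reasoning

  p*q÷q≡p : ∀ p → p ℚ.* q ÷ q ≡ p
  p*q÷q≡p p = begin
    p ℚ.* q ℚ.* 1/ q     ≡⟨ ℚ.*-assoc p q (1/ q) ⟩
    p ℚ.* (q ℚ.* 1/ q)   ≡⟨ cong (p ℚ.*_) (ℚ.*-inverseʳ q) ⟩
    p ℚ.* 1ℚ             ≡⟨ ℚ.*-identityʳ p ⟩
    p                    ∎
    where open ≡-Reasoning

  ℚ-*-cancelʳ-≡ : ∀ {p r} → p ℚ.* q ≡ r ℚ.* q → p ≡ r
  ℚ-*-cancelʳ-≡ {p} {r} pq≡rq = trans (sym (p*q÷q≡p p)) (trans (cong (_÷ q) pq≡rq) (p*q÷q≡p r))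

÷-cross : ∀ p₁ p₂ q₁ q₂ .{{_ : ℚ.NonZero q₁}} .{{_ : ℚ.NonZero q₂}} →
          p₁ ℚ.* q₂ ≡ p₂ ℚ.* q₁ → p₁ ÷ q₁ ≡ p₂ ÷ q₂
÷-cross p₁ p₂ q₁ q₂ p₁q₂≡p₂q₁ = ℚ-*-cancelʳ-≡ {q₁} (ℚ-*-cancelʳ-≡ {q₂} (begin
  p₁ ÷ q₁ ℚ.* q₁ ℚ.* q₂  ≡⟨ cong (ℚ._* q₂) (p÷q*q≡p p₁) ⟩
  p₁ ℚ.* q₂              ≡⟨ p₁q₂≡p₂q₁ ⟩
  p₂ ℚ.* q₁              ≡⟨ cong (ℚ._* q₁) (p÷q*q≡p p₂) ⟨
  p₂ ÷ q₂ ℚ.* q₂ ℚ.* q₁  ≡⟨ ℚ-CS.xy∙z≈xz∙y (p₂ ÷ q₂) q₂ q₁ ⟩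
  p₂ ÷ q₂ ℚ.* q₁ ℚ.* q₂  ∎))
  where
  open ≡-Reasoning
  module ℚ-CS =
    CommutativeSemigroupProperties (CommutativeRing.*-commutativeSemigroup ℚ.+-*-commutativeRing)

divℚ≡÷ : ∀ p q (q≢0 : q ≢ 0ℚ) → divℚ p q ≡ (p ÷ q) {{ℚ.≢-nonZero q≢0}}
divℚ≡÷ p q q≢0 with q ℚ.≟ 0ℚ
... | yes q≡0 = contradiction q≡0 q≢0
... | no _    = refl

divℚ-frac-cross : ∀ {a a′ b b′} d .{{_ : NonZero b}} .{{_ : NonZero b′}} → a * b′ ≡ a′ * b →
                  divℚ (frac a 1) (frac b d) ≡ divℚ (frac a′ 1) (frac b′ d)
-- For d = 0 both sides are the junk value 0ℚ.
divℚ-frac-cross zero _ = refl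
divℚ-frac-cross {a} {a′} {b} {b′} (suc u) ab′≡a′b = begin
  divℚ (frac a 1) (frac b (suc u))    ≡⟨ divℚ≡÷ (frac a 1) (frac b (suc u)) (frac≢0 b u) ⟩
  frac a 1 ÷ frac b (suc u)           ≡⟨ ÷-cross (frac a 1) (frac a′ 1) (frac b (suc u)) (frac b′ (suc u))
                                           (frac-cross {a} {b} {a′} {b′} u ab′≡a′b) ⟩
  frac a′ 1 ÷ frac b′ (suc u)         ≡⟨ divℚ≡÷ (frac a′ 1) (frac b′ (suc u)) (frac≢0 b′ u) ⟨
  divℚ (frac a′ 1) (frac b′ (suc u))  ∎
  where
  open ≡-Reasoning
  instance
    _ = ℚ.≢-nonZero (frac≢0 b u)
    _ = ℚ.≢-nonZero (frac≢0 b′ u)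

corollary1 : (k : ℕ) →
    (0 < lcmUpTo (k ∸ 1)) ×
    ((n : ℕ) → k ≤ n → ratio k (n + lcmUpTo (k ∸ 1)) ≡ ratio k n)
corollary1 k = >-nonZero⁻¹ T {{lcmUpTo-nonZero (k ∸ 1)}} , periodic
  where
  T = lcmUpTo (k ∸ 1)
  ∣T : ∀ i → suc i < k → suc i ∣ T
  ∣T i (s≤s i<k∸1) = 1+i∣lcmUpTo i<k∸1
  ratio≡ : ∀ n → ratio k n ≡ divℚ (frac (n C k) 1) (frac (fallingLcm n k) (lcmUpTo k))
  ratio≡ n = cong (λ l → divℚ (frac (n C k) 1) (frac l (lcmUpTo k))) (lcmDesc≡fallingLcm n k)
  periodic : (n : ℕ) → k ≤ n → ratio k (n + T) ≡ ratio k n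
  periodic n k≤n = begin
    ratio k (n + T)
      ≡⟨ ratio≡ (n + T) ⟩
    divℚ (frac ((n + T) C k) 1) (frac (fallingLcm (n + T) k) (lcmUpTo k))
      ≡⟨ divℚ-frac-cross {a = (n + T) C k} {a′ = n C k} (lcmUpTo k)
           {{fallingLcm-nonZero (≤-trans k≤n (m≤m+n n T))}} {{fallingLcm-nonZero k≤n}}
           (binomial*fallingLcm-periodic T k≤n ∣T) ⟩
    divℚ (frac (n C k) 1) (frac (fallingLcm n k) (lcmUpTo k))
      ≡⟨ ratio≡ n ⟨
    ratio k n
      ∎
    where open ≡-Reasoning
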